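{- For all integers $n\geq 3$ and $q\geq 35$, \[ f(n,q)\le \mathrm{tw}_q(n-1,q), \] i.e. $f(n,q)$ is at most a tower $q^{q^{\cdot^{\cdot^{q}}}}$ consisting of $n-1$ copies of $q$.
   Context: A word over an alphabet is a finite string of letters; a subword of $w$ is a string of consecutive letters of $w$. A word $w$ contains a pattern $P$ if there is a map assigning to each letter of $P$ a nonempty word (different letters may receive equal words) such that the word obtained from $P$ by replacing each letter by its assigned word is a subword of $w$. The Zimin words are defined by $Z_1=x_1$ and $Z_n=Z_{n-1}x_nZ_{n-1}$ with $x_n$ a new letter. $f(n,q)$ denotes the smallest integer such that every word of length $f(n,q)$ over an alphabet of size $q$ contains $Z_n$. Tower notation: $\mathrm{tw}_q(1,x)=x$, $\mathrm{tw}_q(k+1,x)=q^{\mathrm{tw}_q(k,x)}$. -}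

module Defs where

open import Data.Nat using (ℕ; zero; suc; _^_; _<_)
open import Data.Fin using (Fin; fromℕ; inject₁)
open import Data.List using (List; []; _∷_; _++_; [_]; concatMap; length)
open import Data.Product using (Σ; _×_)
open import Relation.Binary.PropositionalEquality using (_≡_)
open import Relation.Nullary using (¬_)

Subword : {A : Set} → List A → List A → Set
Subword {A} s w = Σ (List A) λ u → Σ (List A) λ v → u ++ s ++ v ≡ w

Word : Set → Set
Word A = List A

NonEmpty : {A : Set} → List A → Set
NonEmpty xs = ¬ (xs ≡ [])

Contains : {A B : Set} → Word A → Word B → Set
Contains {A} {B} w P =
  Σ (B → Word A) λ σ → ((b : B) → NonEmpty (σ b)) × Subword (concatMap σ P) w

-- Zimin words over letters x_1..x_n, encoded as Fin n (x_i = i-1).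
-- Z_1 = x_1, Z_{n+1} = Z_n x_{n+1} Z_n.
zimin : (n : ℕ) → Word (Fin (suc n))
zimin zero = [ fromℕ 0 ]
zimin (suc n) = Data.List.map inject₁ (zimin n) ++ [ fromℕ (suc n) ] ++ Data.List.map inject₁ (zimin n)

-- Z n : the Zimin word Z_n for n ≥ 1 (Z n = zimin (n-1)); we only use n ≥ 1.
Z : (n : ℕ) → Word (Fin n)
Z zero = []
Z (suc n) = zimin n

AllContainZimin : ℕ → ℕ → ℕ → Set
AllContainZimin n q L = (w : Word (Fin q)) → length w ≡ L → Contains w (Z n)

IsF : ℕ → ℕ → ℕ → Set
IsF n q m = AllContainZimin n q m × ((L : ℕ) → L < m → ¬ AllContainZimin n q L)

-- Tower: tw q 1 x = x, tw q (k+1) x = q ^ tw q k x  (tw q 0 x := x, unused).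
tw : ℕ → ℕ → ℕ → ℕ
tw q zero x = x
tw q (suc zero) x = x
tw q (suc (suc k)) x = q ^ tw q (suc k) x

-- A word of length 2q + 1 over q letters contains an occurrence x b x of Z₂ in which x b is spelled
-- by runs (of length one or two) of pairwise distinct letters: read the word from the right until a
-- letter returns. There are at most c_q ≈ 2^q q! such words x b. Cut a word of length
-- (c_q + 1)(2q + 2) into c_q + 1 blocks of length 2q + 1 separated by single letters; two blocks
-- carry the same factor X, and X (gap) X is an occurrence of Z₃. The same pigeonhole step with
-- blocks of length N labelled by themselves turns a length N forcing Z_n into (q^N + 1)(N + 1)
-- forcing Z_{n+1}. Finally 2(c_q + 1)(2q + 2) ≤ q^q for q ≥ 35, and 2N ≤ t gives
-- 2(q^N + 1)(N + 1) ≤ q^t, so the bounds stay below the tower.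
module Submission where

open import Defs

open import Data.Bool using (Bool; true; false)
open import Data.Empty using (⊥-elim)
open import Data.Fin using (Fin; zero; suc; toℕ; fromℕ; inject₁; combine; punchOut)
open import Data.Fin.Properties as Finₚ using (pigeonhole; toℕ<n; combine-injective)
open import Data.List as List using (List; []; _∷_; _++_; [_]; concatMap; map; length; take; drop)
open import Data.List.Properties
  using (++-monoid; ++-assoc; ++-identityʳ; ++-conicalˡ; ++-conicalʳ; concatMap-++; concatMap-map; concatMap-cong;
         take++drop≡id; take-[]; drop-drop; length-take; length-drop)
open import Data.List.Relation.Unary.All as All using (All; []; _∷_)
open import Data.List.Relation.Unary.All.Properties using (++⁻ˡ)
open import Data.List.Relation.Unary.AllPairs using (AllPairs; []; _∷_)
open import Data.Nat
  using (ℕ; zero; suc; _+_; _*_; _^_; _∸_; _⊓_; _≤_; _<_; z≤n; s≤s; _≤′_; ≤′-reflexive; ≤′-step)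
open import Data.Nat.Properties
open import Data.Nat.Tactic.RingSolver using (solve-∀)
open import Data.Product using (∃-syntax; _×_; _,_; proj₁; proj₂)
open import Data.Sum using (_⊎_; inj₁; inj₂)
open import Data.Vec using (Vec; lookup; removeAt; allFin)
open import Data.Vec.Properties using (removeAt-punchOut; lookup-allFin)
open import Function using (_∘_)
open import Relation.Binary.Definitions using (DecidableEquality)
open import Relation.Binary.PropositionalEquality
  using (_≡_; _≢_; refl; sym; trans; cong; cong₂; subst; module ≡-Reasoning)
open import Relation.Nullary using (yes; no)
open import Tactic.MonoidSolver using (solve)
open import Algebra.Properties.CommutativeSemigroup *-commutativeSemigroup using (x∙yz≈y∙xz)

module _ {A : Set} where

  subword-trans : {s t w : List A} → Subword s t → Subword t w → Subword s w
  subword-trans (u , v , refl) (u′ , v′ , refl) = u′ ++ u , v ++ v′ , solve (++-monoid A)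

  subword-∷ : ∀ {s w : List A} c → Subword s w → Subword s (c ∷ w)
  subword-∷ c (u , v , eq) = c ∷ u , v , cong (c ∷_) eq

  repeated-subword : {X B B′ C : List A} → Subword X B → Subword X B′ → NonEmpty C →
                     ∃[ Y ] NonEmpty Y × Subword (X ++ Y ++ X) (B ++ C ++ B′)
  repeated-subword {C = C} (u , v , refl) (u′ , v′ , refl) C≢[] =
    v ++ C ++ u′ , Y≢[] , u , v′ , solve (++-monoid A)
    where
    Y≢[] : NonEmpty (v ++ C ++ u′)
    Y≢[] Y≡[] = C≢[] (++-conicalˡ C u′ (++-conicalʳ v _ Y≡[]))

  image : {B : Set} {w : List A} (P : List B) → Contains w P → List A
  image P (σ , _) = concatMap σ P

  contains-subword : {B : Set} {w w′ : List A} {P : List B} → Contains w P → Subword w w′ → Contains w′ P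
  contains-subword (σ , σ≢[] , s) s′ = σ , σ≢[] , subword-trans s s′

  extend : {n : ℕ} → (Fin n → List A) → List A → Fin (suc n) → List A
  extend {zero} σ Y zero = Y
  extend {suc n} σ Y zero = σ zero
  extend {suc n} σ Y (suc i) = extend (σ ∘ suc) Y i

  extend-inject₁ : {n : ℕ} (σ : Fin n → List A) (Y : List A) (i : Fin n) → extend σ Y (inject₁ i) ≡ σ i
  extend-inject₁ {suc n} σ Y zero = refl
  extend-inject₁ {suc n} σ Y (suc i) = extend-inject₁ (σ ∘ suc) Y i

  extend-fromℕ : {n : ℕ} (σ : Fin n → List A) (Y : List A) → extend σ Y (fromℕ n) ≡ Y
  extend-fromℕ {zero} σ Y = refl
  extend-fromℕ {suc n} σ Y = extend-fromℕ (σ ∘ suc) Y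

  extend-nonEmpty : {n : ℕ} {σ : Fin n → List A} {Y : List A} →
                    (∀ i → NonEmpty (σ i)) → NonEmpty Y → ∀ i → NonEmpty (extend σ Y i)
  extend-nonEmpty {zero} σ≢[] Y≢[] zero = Y≢[]
  extend-nonEmpty {suc n} σ≢[] Y≢[] zero = σ≢[] zero
  extend-nonEmpty {suc n} σ≢[] Y≢[] (suc i) = extend-nonEmpty (σ≢[] ∘ suc) Y≢[] i

  concatMap-zimin-suc : ∀ n (σ : Fin (suc n) → List A) (Y : List A) →
    concatMap (extend σ Y) (zimin (suc n)) ≡ concatMap σ (zimin n) ++ Y ++ concatMap σ (zimin n)
  concatMap-zimin-suc n σ Y = begin
    concatMap σ′ (Zᵢ ++ [ fromℕ (suc n) ] ++ Zᵢ)
      ≡⟨ concatMap-++ σ′ Zᵢ _ ⟩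
    concatMap σ′ Zᵢ ++ concatMap σ′ ([ fromℕ (suc n) ] ++ Zᵢ)
      ≡⟨ cong (concatMap σ′ Zᵢ ++_) (concatMap-++ σ′ [ fromℕ (suc n) ] Zᵢ) ⟩
    concatMap σ′ Zᵢ ++ (σ′ (fromℕ (suc n)) ++ []) ++ concatMap σ′ Zᵢ
      ≡⟨ cong₂ (λ X Y′ → X ++ Y′ ++ X) old-letters (trans (++-identityʳ _) (extend-fromℕ σ Y)) ⟩
    X ++ Y ++ X ∎
    where
    open ≡-Reasoning
    σ′ : Fin (suc (suc n)) → List A
    σ′ = extend σ Y
    Zᵢ : List (Fin (suc (suc n)))
    Zᵢ = map inject₁ (zimin n)
    X : List A
    X = concatMap σ (zimin n)
    old-letters : concatMap σ′ Zᵢ ≡ X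
    old-letters = trans (concatMap-map σ′ inject₁ (zimin n)) (concatMap-cong (extend-inject₁ σ Y) (zimin n))

  zimin-square : ∀ {n} (σ : Fin (suc n) → List A) → (∀ i → NonEmpty (σ i)) → {Y : List A} → NonEmpty Y →
                 Contains (concatMap σ (Z (suc n)) ++ Y ++ concatMap σ (Z (suc n))) (Z (suc (suc n)))
  zimin-square {n} σ σ≢[] {Y} Y≢[] =
    extend σ Y , extend-nonEmpty σ≢[] Y≢[] , [] , [] , trans (++-identityʳ _) (concatMap-zimin-suc n σ Y)

  contains-square : ∀ {n} {B B′ C : List A} (c : Contains B (Z (suc n))) → Subword (image (Z (suc n)) c) B′ → NonEmpty C →
                    Contains (B ++ C ++ B′) (Z (suc (suc n)))
  contains-square {n} (σ , σ≢[] , X⊑B) X⊑B′ C≢[] with Y , Y≢[] , XYX⊑ ← repeated-subword X⊑B X⊑B′ C≢[] =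
    contains-subword {P = Z (suc (suc n))} (zimin-square σ σ≢[] Y≢[]) XYX⊑

  take-+ : ∀ m n (xs : List A) → take (m + n) xs ≡ take m xs ++ take n (drop m xs)
  take-+ zero n xs = refl
  take-+ (suc m) n [] = sym (take-[] n)
  take-+ (suc m) n (x ∷ xs) = cong (x ∷_) (take-+ m n xs)

  window-subword : ∀ x L (w : List A) → Subword (take L (drop x w)) w
  window-subword x L w = take x w , drop L (drop x w) , reassemble
    where
    open ≡-Reasoning
    reassemble : take x w ++ take L (drop x w) ++ drop L (drop x w) ≡ w
    reassemble = begin
      take x w ++ take L (drop x w) ++ drop L (drop x w) ≡⟨ cong (take x w ++_) (take++drop≡id L (drop x w)) ⟩
      take x w ++ drop x w                             ≡⟨ take++drop≡id x w ⟩
      w                                                ∎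

  window-length : ∀ x b (w : List A) → x + b ≤ length w → length (take b (drop x w)) ≡ b
  window-length x b w x+b≤|w| = begin
    length (take b (drop x w)) ≡⟨ length-take b (drop x w) ⟩
    b ⊓ length (drop x w)      ≡⟨ cong (b ⊓_) (length-drop x w) ⟩
    b ⊓ (length w ∸ x)         ≡⟨ m≤n⇒m⊓n≡m (m+n≤o⇒m≤o∸n b (subst (_≤ length w) (+-comm x b) x+b≤|w|)) ⟩
    b                          ∎
    where open ≡-Reasoning

  window-nonEmpty : ∀ d x (w : List A) → x < length w → NonEmpty (take (suc d) (drop x w))
  window-nonEmpty d zero (_ ∷ _) _ ()
  window-nonEmpty d (suc x) (_ ∷ w) (s≤s x<|w|) = window-nonEmpty d x w x<|w|

  separated-blocks : ∀ (w : List A) b {x y} → x + b < y → y + b ≤ length w →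
                     ∃[ C ] NonEmpty C × Subword (take b (drop x w) ++ C ++ take b (drop y w)) w
  separated-blocks w b {x} x+b<y y+b≤|w| with d , refl ← m≤n⇒∃[o]m+o≡n x+b<y =
    take (suc d) (drop (x + b) w) , window-nonEmpty d (x + b) w x+b<|w| ,
    subst (λ s → Subword s w) three-windows (window-subword x (b + (suc d + b)) w)
    where
    open ≡-Reasoning
    D : List A
    D = drop x w
    x+b<|w| : x + b < length w
    x+b<|w| = <-≤-trans x+b<y (≤-trans (m≤m+n _ b) y+b≤|w|)
    three-windows : take (b + (suc d + b)) D ≡ take b D ++ take (suc d) (drop (x + b) w) ++ take b (drop (suc (x + b) + d) w)
    three-windows = begin
      take (b + (suc d + b)) D
        ≡⟨ take-+ b (suc d + b) D ⟩
      take b D ++ take (suc d + b) (drop b D)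
        ≡⟨ cong (take b D ++_) (take-+ (suc d) b (drop b D)) ⟩
      take b D ++ take (suc d) (drop b D) ++ take b (drop (suc d) (drop b D))
        ≡⟨ cong₂ (λ E E′ → take b D ++ take (suc d) E ++ take b E′) (drop-drop x b w) second-offset ⟩
      take b D ++ take (suc d) (drop (x + b) w) ++ take b (drop (suc (x + b) + d) w) ∎
      where
      second-offset : drop (suc d) (drop b D) ≡ drop (suc (x + b) + d) w
      second-offset = begin
        drop (suc d) (drop b D)   ≡⟨ drop-drop b (suc d) D ⟩
        drop (b + suc d) D        ≡⟨ drop-drop x (b + suc d) w ⟩
        drop (x + (b + suc d)) w  ≡⟨ cong (λ o → drop o w) (trans (sym (+-assoc x b (suc d))) (+-suc (x + b) d)) ⟩
        drop (suc (x + b) + d) w  ∎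

  record Collision {K b : ℕ} (label : (W : List A) → length W ≡ b → Fin K) (w : List A) : Set where
    field
      B B′ C : List A
      B-length : length B ≡ b
      B′-length : length B′ ≡ b
      same-label : label B B-length ≡ label B′ B′-length
      C≢[] : NonEmpty C
      separated : Subword (B ++ C ++ B′) w

  -- Cut w into K + 1 blocks of length b, each followed by one spare letter; two of them share a label.
  collision : ∀ b K (label : (W : List A) → length W ≡ b → Fin K) (w : List A) → suc K * suc b ≤ length w →
              Collision label w
  collision b K label w w-long = from-pigeonhole (pigeonhole (n<1+n K) (λ i → label (block i) (block-length i)))
    where
    block-before : ∀ a {a′} → suc a ≤ a′ → a * suc b + b < a′ * suc b
    block-before a a<a′ = <-≤-trans (s≤s (≤-reflexive (+-comm (a * suc b) b))) (*-monoˡ-≤ (suc b) a<a′)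
    block-fits : (i : Fin (suc K)) → toℕ i * suc b + b ≤ length w
    block-fits i = ≤-trans (<⇒≤ (block-before (toℕ i) (toℕ<n i))) w-long
    block : Fin (suc K) → List A
    block i = take b (drop (toℕ i * suc b) w)
    block-length : ∀ i → length (block i) ≡ b
    block-length i = window-length (toℕ i * suc b) b w (block-fits i)
    from-pigeonhole : (∃[ i ] ∃[ j ] toℕ i < toℕ j × label (block i) (block-length i) ≡ label (block j) (block-length j)) →
                      Collision label w
    from-pigeonhole (i , j , i<j , same)
      with C , C≢[] , separated ← separated-blocks w b (block-before (toℕ i) i<j) (block-fits j) =
      record { B = block i ; B′ = block j ; C = C ; B-length = block-length i ; B′-length = block-length j
             ; same-label = same ; C≢[] = C≢[] ; separated = separated }

  zimin-doubling : ∀ n b K (occurrence : (W : List A) → length W ≡ b → Contains W (Z (suc n)))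
    (label : (W : List A) → length W ≡ b → Fin K) →
    (∀ W W′ (e : length W ≡ b) (e′ : length W′ ≡ b) → label W e ≡ label W′ e′ →
       image (Z (suc n)) (occurrence W e) ≡ image (Z (suc n)) (occurrence W′ e′)) →
    (w : List A) → suc K * suc b ≤ length w → Contains w (Z (suc (suc n)))
  zimin-doubling n b K occurrence label determines w w-long =
    contains-subword {P = Z (suc (suc n))} (contains-square (occurrence B B-length) X⊑B′ C≢[]) separated
    where
    open Collision (collision b K label w w-long)
    X⊑B′ : Subword (image (Z (suc n)) (occurrence B B-length)) B′
    X⊑B′ = subst (λ X → Subword X B′) (sym (determines B B′ B-length B′-length same-label))
                 (proj₂ (proj₂ (occurrence B′ B′-length)))

Run : Set → Set
Run A = A × Bool

runWordCount : ℕ → ℕ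
runWordCount zero = 1
runWordCount (suc k) = suc (suc k * (2 * runWordCount k))

bit : Bool → Fin 2
bit false = zero
bit true = suc zero

bit-injective : ∀ {d d′} → bit d ≡ bit d′ → d ≡ d′
bit-injective {false} {false} _ = refl
bit-injective {true} {true} _ = refl

module _ {A : Set} where

  echo : Run A → List A
  echo (_ , false) = []
  echo (x , true) = [ x ]

  letters : Run A → List A
  letters r = proj₁ r ∷ echo r

  expand : List (Run A) → List A
  expand = concatMap letters

  DistinctRuns : List (Run A) → Set
  DistinctRuns = AllPairs (λ r s → proj₁ r ≢ proj₁ s)

  RunSpelling : List A → Set
  RunSpelling W = ∃[ R ] DistinctRuns R × expand R ≡ W

  distinct-prefix : ∀ R₁ {R₂} → DistinctRuns (R₁ ++ R₂) → DistinctRuns R₁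
  distinct-prefix [] _ = []
  distinct-prefix (_ ∷ R₁) (r∉R ∷ D) = ++⁻ˡ R₁ r∉R ∷ distinct-prefix R₁ D

  -- w consists of runs of length one or two of distinct letters taken from av.
  data RunWord : ∀ {k} → Vec A k → List A → Set where
    [] : ∀ {k} {av : Vec A k} → RunWord av []
    run : ∀ {k} {av : Vec A (suc k)} {w} (i : Fin (suc k)) (d : Bool) → RunWord (removeAt av i) w →
          RunWord av (letters (lookup av i , d) ++ w)

  runWord-length : ∀ {k} {av : Vec A k} {w} → RunWord av w → length w ≤ k + k
  runWord-length [] = z≤n
  runWord-length {suc k} (run i false r) = s≤s (≤-trans (runWord-length r) (+-monoʳ-≤ k (n≤1+n k)))
  runWord-length {suc k} (run {w = w} i true r) = s≤s (subst (suc (length w) ≤_) (sym (+-suc k k)) (s≤s (runWord-length r)))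

  Listed : ∀ {k} → Vec A k → A → Set
  Listed av x = ∃[ i ] lookup av i ≡ x

  listed-removeAt : ∀ {k} (av : Vec A (suc k)) i {y} → lookup av i ≢ y → Listed av y → Listed (removeAt av i) y
  listed-removeAt av i x≢y (j , refl) = punchOut i≢j , removeAt-punchOut av i≢j
    where
    i≢j : i ≢ j
    i≢j refl = x≢y refl

  runWord : ∀ {k} (av : Vec A k) (R : List (Run A)) → DistinctRuns R → All (Listed av ∘ proj₁) R → RunWord av (expand R)
  runWord av [] _ _ = []
  runWord {zero} av (_ ∷ _) _ ((() , _) ∷ _)
  runWord {suc k} av ((_ , d) ∷ R) (x∉R ∷ D) ((i , refl) ∷ listed) =
    run i d (runWord (removeAt av i) R D (All.zipWith (λ (x≢y , y∈av) → listed-removeAt av i x≢y y∈av) (x∉R , listed)))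

  code : ∀ {k} {av : Vec A k} {w} → RunWord av w → Fin (runWordCount k)
  code {zero} [] = zero
  code {suc k} [] = zero
  code (run i d r) = suc (combine i (combine (bit d) (code r)))

  code-injective : ∀ {k} {av : Vec A k} {w w′} (r : RunWord av w) (r′ : RunWord av w′) → code r ≡ code r′ → w ≡ w′
  code-injective [] [] _ = refl
  code-injective {suc k} [] (run _ _ _) ()
  code-injective {suc k} (run _ _ _) [] ()
  code-injective {av = av} (run i d r) (run i′ d′ r′) eq
    with refl , eq′ ← combine-injective i _ i′ _ (Finₚ.suc-injective eq)
    with bd , eq″ ← combine-injective (bit d) _ (bit d′) _ eq′
    with refl ← bit-injective bd
    = cong (letters (lookup av i , d) ++_) (code-injective r r′ eq″)

  record ReturnFactor (W : List A) : Set where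
    field
      x : A
      b : List A
      b≢[] : NonEmpty b
      runs : List (Run A)
      distinct : DistinctRuns runs
      spells : expand runs ≡ x ∷ b
      occurs : Subword (x ∷ b ++ [ x ]) W

  returnFactor-∷ : ∀ {W} c → ReturnFactor W → ReturnFactor (c ∷ W)
  returnFactor-∷ c F = record { ReturnFactor F ; occurs = subword-∷ c (ReturnFactor.occurs F) }

  returnFactor-contains : ∀ {W} → ReturnFactor W → Contains W (Z 2)
  returnFactor-contains F = σ , σ≢[] , occurs
    where
    open ReturnFactor F
    σ : Fin 2 → List A
    σ zero = [ x ]
    σ (suc zero) = b
    σ≢[] : ∀ i → NonEmpty (σ i)
    σ≢[] zero ()
    σ≢[] (suc zero) = b≢[]

  module _ (_≟_ : DecidableEquality A) where

    locate : ∀ c (R : List (Run A)) →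
      (∃[ R₁ ] ∃[ e ] ∃[ R₂ ] R ≡ R₁ ++ (c , e) ∷ R₂ × All (λ r → c ≢ proj₁ r) R₁) ⊎ All (λ r → c ≢ proj₁ r) R
    locate c [] = inj₂ []
    locate c ((y , d) ∷ R) with c ≟ y
    ... | yes refl = inj₁ ([] , d , R , refl , [])
    ... | no c≢y with locate c R
    ...   | inj₁ (R₁ , e , R₂ , refl , c∉R₁) = inj₁ ((y , d) ∷ R₁ , e , R₂ , refl , c≢y ∷ c∉R₁)
    ...   | inj₂ c∉R = inj₂ (c≢y ∷ c∉R)

    -- c either extends the spelling or returns: into its own doubled run (c c c), or after a nonempty stretch.
    returnFactor-or-spelling-∷ : ∀ c R → DistinctRuns R → ReturnFactor (c ∷ expand R) ⊎ RunSpelling (c ∷ expand R)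
    returnFactor-or-spelling-∷ c R D with locate c R
    ... | inj₂ c∉R = inj₂ ((c , false) ∷ R , c∉R ∷ D , refl)
    returnFactor-or-spelling-∷ c R (c∉R₂ ∷ D) | inj₁ ([] , false , R₂ , refl , []) =
      inj₂ ((c , true) ∷ R₂ , c∉R₂ ∷ D , refl)
    ... | inj₁ ([] , true , R₂ , refl , []) = inj₁ record
      { x = c ; b = [ c ] ; b≢[] = λ () ; runs = [ (c , true) ] ; distinct = [] ∷ [] ; spells = refl
      ; occurs = [] , expand R₂ , refl }
    ... | inj₁ (R₁@(_ ∷ _) , e , R₂ , refl , c∉R₁) = inj₁ record
      { x = c ; b = expand R₁ ; b≢[] = λ () ; runs = (c , false) ∷ R₁
      ; distinct = c∉R₁ ∷ distinct-prefix R₁ D ; spells = refl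
      ; occurs = [] , echo (c , e) ++ expand R₂ , cong (c ∷_) reassemble }
      where
      reassemble : (expand R₁ ++ [ c ]) ++ echo (c , e) ++ expand R₂ ≡ expand (R₁ ++ (c , e) ∷ R₂)
      reassemble = trans (++-assoc (expand R₁) [ c ] _) (sym (concatMap-++ letters R₁ ((c , e) ∷ R₂)))

    returnFactor-or-spelling : ∀ W → ReturnFactor W ⊎ RunSpelling W
    returnFactor-or-spelling [] = inj₂ ([] , [] , refl)
    returnFactor-or-spelling (c ∷ W) with returnFactor-or-spelling W
    ... | inj₁ F = inj₁ (returnFactor-∷ c F)
    ... | inj₂ (R , D , refl) = returnFactor-or-spelling-∷ c R D

module _ {q : ℕ} where

  runWord-allFin : (R : List (Run (Fin q))) → DistinctRuns R → RunWord (allFin q) (expand R)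
  runWord-allFin R D = runWord (allFin q) R D (All.universal (λ r → proj₁ r , lookup-allFin (proj₁ r)) R)

  -- A word with no return factor is spelled by distinct runs, so it has at most 2q letters.
  long-word-returnFactor : (W : List (Fin q)) → q + q < length W → ReturnFactor W
  long-word-returnFactor W q+q<|W| with returnFactor-or-spelling Finₚ._≟_ W
  ... | inj₁ F = F
  ... | inj₂ (R , D , refl) = ⊥-elim (<⇒≱ q+q<|W| (runWord-length (runWord-allFin R D)))

  returnLabel : ∀ {W} → ReturnFactor W → Fin (runWordCount q)
  returnLabel F = code (runWord-allFin runs distinct) where open ReturnFactor F

  returnLabel-injective : ∀ {W W′} (F : ReturnFactor W) (F′ : ReturnFactor W′) → returnLabel F ≡ returnLabel F′ →
    image (Z 2) (returnFactor-contains F) ≡ image (Z 2) (returnFactor-contains F′)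
  returnLabel-injective F F′ eq =
    return-image (trans (sym (spells F)) (trans (code-injective _ _ eq) (spells F′)))
    where
    open ReturnFactor
    return-image : ∀ {x x′ : Fin q} {b b′ : List (Fin q)} → x ∷ b ≡ x′ ∷ b′ → x ∷ b ++ [ x ] ≡ x′ ∷ b′ ++ [ x′ ]
    return-image refl = refl

encode : ∀ {q} L (W : List (Fin q)) → length W ≡ L → Fin (q ^ L)
encode zero [] _ = zero
encode (suc L) (a ∷ W) e = combine a (encode L W (suc-injective e))

encode-injective : ∀ {q} L (W W′ : List (Fin q)) e e′ → encode L W e ≡ encode L W′ e′ → W ≡ W′
encode-injective zero [] [] _ _ _ = refl
encode-injective (suc L) (a ∷ W) (a′ ∷ W′) e e′ eq with refl , eq′ ← combine-injective a _ a′ _ eq =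
  cong (List._∷_ a) (encode-injective L W W′ _ _ eq′)

Threshold : ℕ → ℕ → ℕ → Set
Threshold n q N = (w : Word (Fin q)) → N ≤ length w → Contains w (Z n)

f≤threshold : ∀ {n q m N} → IsF n q m → Threshold n q N → m ≤ N
f≤threshold (_ , minimal) contains = ≮⇒≥ λ N<m → minimal _ N<m λ w |w|≡N → contains w (≤-reflexive (sym |w|≡N))

threshold₃ : ℕ → ℕ
threshold₃ q = suc (runWordCount q) * suc (suc (q + q))

threshold-Z₃ : ∀ q → Threshold 3 q (threshold₃ q)
threshold-Z₃ q = zimin-doubling 1 (suc (q + q)) (runWordCount q) occurrence label determines
  where
  factor : (W : List (Fin q)) → length W ≡ suc (q + q) → ReturnFactor W
  factor W e = long-word-returnFactor W (≤-reflexive (sym e))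
  occurrence : (W : List (Fin q)) → length W ≡ suc (q + q) → Contains W (Z 2)
  occurrence W e = returnFactor-contains (factor W e)
  label : (W : List (Fin q)) → length W ≡ suc (q + q) → Fin (runWordCount q)
  label W e = returnLabel (factor W e)
  determines : ∀ W W′ (e : length W ≡ suc (q + q)) (e′ : length W′ ≡ suc (q + q)) → label W e ≡ label W′ e′ →
               image (Z 2) (occurrence W e) ≡ image (Z 2) (occurrence W′ e′)
  determines W W′ e e′ = returnLabel-injective (factor W e) (factor W′ e′)

-- Blocks of length N are labelled by themselves.
threshold-suc : ∀ {n q N} → Threshold (suc n) q N → Threshold (suc (suc n)) q (suc (q ^ N) * suc N)
threshold-suc {n} {q} {N} contains = zimin-doubling n N (q ^ N) occurrence (encode N) determines
  where
  occurrence : (W : List (Fin q)) → length W ≡ N → Contains W (Z (suc n))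
  occurrence W e = contains W (≤-reflexive (sym e))
  determines : ∀ W W′ (e : length W ≡ N) (e′ : length W′ ≡ N) → encode N W e ≡ encode N W′ e′ →
               image (Z (suc n)) (occurrence W e) ≡ image (Z (suc n)) (occurrence W′ e′)
  determines W _ e e′ eq with refl ← encode-injective N W _ e e′ eq with refl ← ≡-irrelevant e e′ = refl

≥-induction : ∀ {P : ℕ → Set} {m} → P m → (∀ {n} → m ≤ n → P n → P (suc n)) → ∀ {n} → m ≤ n → P n
≥-induction {P} {m} base step m≤n = go (≤⇒≤′ m≤n)
  where
  go : ∀ {n} → m ≤′ n → P n
  go (≤′-reflexive refl) = base
  go (≤′-step m≤′n) = step (≤′⇒≤ m≤′n) (go m≤′n)

-- The first three terms of the binomial expansion of (q + 1)^(j + 1), scaled by 2q² to stay in ℕ.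
binomial-three-terms : ∀ q j → q ^ suc j * (2 * q * q + 2 * suc j * q + suc j * j) ≤ 2 * q * q * suc q ^ suc j
binomial-three-terms q zero = ≤-reflexive (base-identity q)
  where
  base-identity : ∀ q → q * 1 * (2 * q * q + 2 * 1 * q + 1 * 0) ≡ 2 * q * q * (suc q * 1)
  base-identity = solve-∀
binomial-three-terms q (suc j) = begin
  q ^ suc (suc j) * (2 * q * q + 2 * suc (suc j) * q + suc (suc j) * suc j)
    ≤⟨ m≤m+n _ (q ^ suc j * (suc j * j)) ⟩
  q ^ suc (suc j) * (2 * q * q + 2 * suc (suc j) * q + suc (suc j) * suc j) + q ^ suc j * (suc j * j)
    ≡⟨ step-identity q j (q ^ suc j) ⟩
  suc q * (q ^ suc j * (2 * q * q + 2 * suc j * q + suc j * j))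
    ≤⟨ *-monoʳ-≤ (suc q) (binomial-three-terms q j) ⟩
  suc q * (2 * q * q * suc q ^ suc j)
    ≡⟨ x∙yz≈y∙xz (suc q) (2 * q * q) (suc q ^ suc j) ⟩
  2 * q * q * suc q ^ suc (suc j) ∎
  where
  open ≤-Reasoning
  step-identity : ∀ q j X → q * X * (2 * q * q + 2 * suc (suc j) * q + suc (suc j) * suc j) + X * (suc j * j)
                            ≡ suc q * (X * (2 * q * q + 2 * suc j * q + suc j * j))
  step-identity = solve-∀

-- (1 + 1/q)^q ≥ 2 + (q - 1)/(2q) is just enough here; first-order Bernoulli would not suffice.
pow-growth : ∀ {q} → 5 ≤ q → 2 * (q + 2) * q ^ q ≤ suc q ^ suc q
pow-growth (s≤s (s≤s (s≤s (s≤s (s≤s (z≤n {r})))))) = *-cancelˡ-≤ (2 * q * q) (begin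
  2 * q * q * (2 * (q + 2) * q ^ q)
    ≤⟨ m≤m+n _ (q * q ^ q * (4 + 6 * r + r * r)) ⟩
  2 * q * q * (2 * (q + 2) * q ^ q) + q * q ^ q * (4 + 6 * r + r * r)
    ≡⟨ growth-identity r (q ^ q) ⟩
  suc q * (q ^ q * (2 * q * q + 2 * q * q + q * p))
    ≤⟨ *-monoʳ-≤ (suc q) (binomial-three-terms q p) ⟩
  suc q * (2 * q * q * suc q ^ q)
    ≡⟨ x∙yz≈y∙xz (suc q) (2 * q * q) (suc q ^ q) ⟩
  2 * q * q * suc q ^ suc q ∎)
  where
  open ≤-Reasoning
  p q : ℕ
  p = 4 + r
  q = suc p
  growth-identity : ∀ r X →
    2 * (5 + r) * (5 + r) * (2 * ((5 + r) + 2) * X) + (5 + r) * X * (4 + 6 * r + r * r)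
    ≡ suc (5 + r) * (X * (2 * (5 + r) * (5 + r) + 2 * (5 + r) * (5 + r) + (5 + r) * (4 + r)))
  growth-identity = solve-∀

threshold₃-suc : ∀ q → threshold₃ (suc q) ≤ 2 * (q + 2) * threshold₃ q
threshold₃-suc q = begin
  threshold₃ (suc q)                     ≤⟨ m≤m+n _ (4 * q * (q + 2)) ⟩
  threshold₃ (suc q) + 4 * q * (q + 2)   ≡⟨ identity q (runWordCount q) ⟩
  2 * (q + 2) * threshold₃ q             ∎
  where
  open ≤-Reasoning
  identity : ∀ q c → suc (suc (suc q * (2 * c))) * suc (suc (suc q + suc q)) + 4 * q * (q + 2)
                     ≡ 2 * (q + 2) * (suc c * suc (suc (q + q)))
  identity = solve-∀

threshold₃-bound : ∀ {q} → 35 ≤ q → 2 * threshold₃ q ≤ q ^ q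
threshold₃-bound = ≥-induction {P = λ q → 2 * threshold₃ q ≤ q ^ q} (≤ᵇ⇒≤ _ _ _) step
  where
  open ≤-Reasoning
  step : ∀ {q} → 35 ≤ q → 2 * threshold₃ q ≤ q ^ q → 2 * threshold₃ (suc q) ≤ suc q ^ suc q
  step {q} q≥35 ih = begin
    2 * threshold₃ (suc q)              ≤⟨ *-monoʳ-≤ 2 (threshold₃-suc q) ⟩
    2 * (2 * (q + 2) * threshold₃ q)    ≡⟨ x∙yz≈y∙xz 2 (2 * (q + 2)) (threshold₃ q) ⟩
    2 * (q + 2) * (2 * threshold₃ q)    ≤⟨ *-monoʳ-≤ (2 * (q + 2)) ih ⟩
    2 * (q + 2) * q ^ q                 ≤⟨ pow-growth (≤-trans (m≤m+n 5 30) q≥35) ⟩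
    suc q ^ suc q                       ∎

4*suc≤2^ : ∀ {N} → 5 ≤ N → 4 * suc N ≤ 2 ^ N
4*suc≤2^ = ≥-induction {P = λ N → 4 * suc N ≤ 2 ^ N} (≤ᵇ⇒≤ _ _ _) step
  where
  open ≤-Reasoning
  step : ∀ {N} → 5 ≤ N → 4 * suc N ≤ 2 ^ N → 4 * suc (suc N) ≤ 2 ^ suc N
  step {N} _ ih = begin
    4 * suc (suc N)           ≤⟨ m≤m+n _ (4 * N) ⟩
    4 * suc (suc N) + 4 * N   ≡⟨ identity N ⟩
    2 * (4 * suc N)           ≤⟨ *-monoʳ-≤ 2 ih ⟩
    2 * 2 ^ N                 ∎
    where
    identity : ∀ N → 4 * suc (suc N) + 4 * N ≡ 2 * (4 * suc N)
    identity = solve-∀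

threshold-suc-bound : ∀ {q N t} → 2 ≤ q → 5 ≤ N → 2 * N ≤ t → 2 * (suc (q ^ N) * suc N) ≤ q ^ t
threshold-suc-bound {q} {N} {t} q≥2@(s≤s (s≤s _)) N≥5 2N≤t = begin
  2 * (suc P * suc N)    ≤⟨ *-monoʳ-≤ 2 (*-monoˡ-≤ (suc N) suc-P≤P+P) ⟩
  2 * ((P + P) * suc N)  ≡⟨ identity P N ⟩
  P * (4 * suc N)        ≤⟨ *-monoʳ-≤ P (4*suc≤2^ N≥5) ⟩
  P * 2 ^ N              ≤⟨ *-monoʳ-≤ P (^-monoˡ-≤ N q≥2) ⟩
  P * q ^ N              ≡⟨ ^-distribˡ-+-* q N N ⟨
  q ^ (N + N)            ≤⟨ ^-monoʳ-≤ q (subst (_≤ t) (cong (N +_) (+-identityʳ N)) 2N≤t) ⟩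
  q ^ t                  ∎
  where
  open ≤-Reasoning
  P : ℕ
  P = q ^ N
  suc-P≤P+P : suc P ≤ P + P
  suc-P≤P+P = subst (_≤ P + P) (+-comm P 1) (+-monoʳ-≤ P (m^n>0 q N))
  identity : ∀ P N → 2 * ((P + P) * suc N) ≡ P * (4 * suc N)
  identity = solve-∀

tower-threshold : ∀ {q} → 35 ≤ q → ∀ k → ∃[ N ] Threshold (3 + k) q N × 5 ≤ N × 2 * N ≤ tw q (2 + k) q
tower-threshold {q} q≥35 zero = threshold₃ q , threshold-Z₃ q , 5≤threshold₃ , threshold₃-bound q≥35
  where
  5≤threshold₃ : 5 ≤ threshold₃ q
  5≤threshold₃ = ≤-trans (s≤s (s≤s (≤-trans (≤-trans (m≤m+n 3 32) q≥35) (m≤m+n q q))))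
                         (m≤n*m _ (suc (runWordCount q)))
tower-threshold {q} q≥35 (suc k) with N , contains , N≥5 , 2N≤tw ← tower-threshold q≥35 k =
  suc (q ^ N) * suc N , threshold-suc contains ,
  ≤-trans N≥5 (≤-trans (n≤1+n N) (m≤n*m (suc N) (suc (q ^ N)))) ,
  threshold-suc-bound (≤-trans (m≤m+n 2 33) q≥35) N≥5 2N≤tw

theorem2p3 : (n q : ℕ) → 3 ≤ n → 35 ≤ q → (m : ℕ) → IsF n q m → m ≤ tw q (n ∸ 1) q
theorem2p3 (suc (suc (suc k))) q (s≤s (s≤s (s≤s _))) q≥35 m isF
  with N , contains , _ , 2N≤tw ← tower-threshold q≥35 k =
  ≤-trans (f≤threshold isF contains) (≤-trans (m≤m+n N (N + 0)) 2N≤tw)
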